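{- Let $G$ be a finite graph and $d\colon V(G)\to\mathbb N$. Then $\mathrm{tw}(G,d)=\mathrm{ew}(G,d)$.
   Context: Graphs are finite and undirected. A tree decomposition of $G$ is a pair $(T,B)$ with $T$ a rooted tree and $B=(B_t)_{t\in T}$ subsets of $V(G)$ (pieces) such that every vertex lies in some piece, every edge is contained in some piece, and for each vertex $v$ the set $\{t: v\in B_t\}$ is connected in $T$; its width is $\max_t|B_t|-1$. For a rooted tree $T$, $<_T$ is the tree order with the root as smallest element. For a vertex $v$, $t_v$ denotes the $<_T$-minimal node $t$ with $v\in B_t$. The decomposition is $d$-stratified if all $u,v\in V(G)$ with $t_u<_T t_v$ satisfy $d(u)\le d(v)$. $\mathrm{tw}(G,d)$ is the minimum width of a $d$-stratified tree decomposition of $G$. An elimination ordering of $(G,d)$ is a linear ordering $(v_1,\dots,v_n)$ of $V(G)$ such that $i<j$ implies $d(v_i)\le d(v_j)$. With it associate graphs $G_n:=G$, and for $1<i\le n$, $G_{i-1}$ has vertex set $V(G_i)\setminus\{v_i\}$ and edge set $\{e\in E(G_i): v_i\notin e\}\cup\{\{u,w\}: u\ne w,\ \{u,v_i\},\{v_i,w\}\in E(G_i)\}$. The width of the ordering is $\max_{i}\deg_{G_i}(v_i)$, and $\mathrm{ew}(G,d)$ is the minimum width of an elimination ordering of $(G,d)$. -}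

module Defs where

open import Data.Nat using (ℕ; zero; suc; _≤_; _∸_; _⊔_)
open import Data.Fin using (Fin; zero; suc; toℕ)
open import Data.Fin.Subset using (Subset; _∈_; ∣_∣)
open import Data.Fin.Properties using (_≟_)
open import Data.Bool using (Bool; true; false; _∧_; _∨_; not; if_then_else_)
open import Data.List using (List; []; _∷_; map; allFin; reverse)
open import Data.Nat.ListAction using (sum)
open import Data.List.Relation.Unary.AllPairs using (AllPairs)
open import Data.List.Relation.Binary.Permutation.Propositional using (_↭_)
open import Data.Product using (Σ; ∃; _×_; _,_)
open import Data.Sum using (_⊎_)
open import Relation.Binary.PropositionalEquality using (_≡_; _≢_)
open import Relation.Nullary using (¬_; does)

record Graph (n : ℕ) : Set where
  field
    adj    : Fin n → Fin n → Bool
    sym    : ∀ u v → adj u v ≡ adj v u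
    irrefl : ∀ v → adj v v ≡ false
open Graph public

maxF : ∀ {k} → (Fin k → ℕ) → ℕ
maxF {zero}  f = 0
maxF {suc k} f = f zero ⊔ maxF (λ i → f (suc i))

-- Rooted trees: nodes Fin (suc m), root = zero, node (suc i) has parent
-- (parent i) which has a strictly smaller index.

record RootedTree : Set where
  field
    size    : ℕ
    parent  : Fin size → Fin (suc size)
    parent< : ∀ i → toℕ (parent i) ≤ toℕ i
open RootedTree public

Node : RootedTree → Set
Node T = Fin (suc (size T))

TAdj : (T : RootedTree) → Node T → Node T → Set
TAdj T t s = (∃ λ i → t ≡ suc i × s ≡ parent T i) ⊎ (∃ λ i → s ≡ suc i × t ≡ parent T i)

-- tree order <=_T : t ≤T s iff t lies on the path from the root to s
data TreeLeq (T : RootedTree) : Node T → Node T → Set where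
  tl-refl : ∀ {t} → TreeLeq T t t
  tl-step : ∀ {t} i → TreeLeq T t (parent T i) → TreeLeq T t (suc i)

TreeLt : (T : RootedTree) → Node T → Node T → Set
TreeLt T t s = TreeLeq T t s × t ≢ s

data Walk (T : RootedTree) (X : Node T → Set) : Node T → Node T → Set where
  here : ∀ {t} → X t → Walk T X t t
  step : ∀ {t r s} → X t → TAdj T t r → Walk T X r s → Walk T X t s

Connected : (T : RootedTree) → (Node T → Set) → Set
Connected T X = ∀ t s → X t → X s → Walk T X t s

record TreeDecomposition {n} (G : Graph n) (T : RootedTree) : Set where
  field
    bag       : Node T → Subset n
    cover     : ∀ v → ∃ λ t → v ∈ bag t
    edgeCover : ∀ u v → adj G u v ≡ true → ∃ λ t → u ∈ bag t × v ∈ bag t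
    connected : ∀ v → Connected T (λ t → v ∈ bag t)
open TreeDecomposition public

width : ∀ {n} {G : Graph n} {T} → TreeDecomposition G T → ℕ
width D = maxF (λ t → ∣ bag D t ∣) ∸ 1

-- t is a <_T-minimal node whose piece contains v  (i.e. t = t_v)
IsTop : ∀ {n} {G : Graph n} {T} → TreeDecomposition G T → Fin n → Node T → Set
IsTop {T = T} D v t = v ∈ bag D t × (∀ t' → v ∈ bag D t' → ¬ TreeLt T t' t)

Stratified : ∀ {n} {G : Graph n} {T} → (Fin n → ℕ) → TreeDecomposition G T → Set
Stratified {n} {T = T} d D =
  ∀ (u v : Fin n) t s → IsTop D u t → IsTop D v s → TreeLt T t s → d u ≤ d v

IsTw : ∀ {n} → Graph n → (Fin n → ℕ) → ℕ → Set
IsTw G d k =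
  (Σ RootedTree λ T → Σ (TreeDecomposition G T) λ D → Stratified d D × width D ≡ k)
  × (∀ T (D : TreeDecomposition G T) → Stratified d D → k ≤ width D)

IsElimOrdering : ∀ {n} → (Fin n → ℕ) → List (Fin n) → Set
IsElimOrdering {n} d vs = (vs ↭ allFin n) × AllPairs (λ u v → d u ≤ d v) vs

degree : ∀ {n} → (Fin n → Fin n → Bool) → Fin n → ℕ
degree {n} E v = sum (map (λ w → if E v w then 1 else 0) (allFin n))

-- adjacency of G_{i-1} computed from the adjacency E of G_i, eliminating v = v_i
eliminate : ∀ {n} → (Fin n → Fin n → Bool) → Fin n → Fin n → Fin n → Bool
eliminate E v u w =
  (E u w ∧ not (does (u ≟ v)) ∧ not (does (w ≟ v)))
  ∨ (not (does (u ≟ w)) ∧ E u v ∧ E v w)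

-- given (v_i, v_{i-1}, ..., v_1) and the adjacency of G_i,
-- returns max_{j ≤ i} deg_{G_j}(v_j)
elimWidth : ∀ {n} → List (Fin n) → (Fin n → Fin n → Bool) → ℕ
elimWidth []       E = 0
elimWidth (v ∷ vs) E = degree E v ⊔ elimWidth vs (eliminate E v)

orderingWidth : ∀ {n} → Graph n → List (Fin n) → ℕ
orderingWidth G vs = elimWidth (reverse vs) (adj G)

IsEw : ∀ {n} → Graph n → (Fin n → ℕ) → ℕ → Set
IsEw {n} G d k =
  (Σ (List (Fin n)) λ vs → IsElimOrdering d vs × orderingWidth G vs ≡ k)
  × (∀ vs → IsElimOrdering d vs → k ≤ orderingWidth G vs)

-- From an elimination ordering, re-insert the
-- vertices in reverse order of elimination; each vertex v gets a new leaf piece {v} ∪ N(v), where N(v) is its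
-- neighbourhood in the graph G_i in which it is eliminated, hung below the piece of the most recently inserted
-- neighbour. That piece already contains all of N(v), because N(v) is a clique in G_{i-1}, so this is a tree
-- decomposition; it is d-stratified, and its width is the width of the ordering. Conversely, given a
-- d-stratified decomposition, eliminate the vertices in decreasing lexicographic order of d(v) and the index
-- of t_v: every edge of the current graph stays inside a piece, and when v is eliminated all its neighbours
-- lie in the piece t_v, so no degree exceeds the width. Finally ew is attained, as there are only finitely
-- many orderings.
module Submission where

open import Defs hiding (sym)
open import Data.Bool as Bool using (Bool; true; false; _∧_; _∨_; not; if_then_else_)
open import Data.Bool.Properties using (∧-comm; ∨-zeroʳ)
open import Data.Fin using (Fin; zero; suc; toℕ; inject₁; fromℕ)
open import Data.Fin.Properties using (_≟_; toℕ<n; toℕ-inject₁; toℕ-fromℕ; toℕ-injective; inject₁-injective)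
open import Data.Fin.Relation.Unary.Top using (view; ‵fromℕ; ‵inject₁)
open import Data.Fin.Subset using (Subset; _∈_; ∣_∣) renaming (⊥ to ∅)
import Data.Fin.Subset.Properties as Subset
open import Data.List as List using (List; []; _∷_; [_]; _++_; length; reverse; allFin; cartesianProductWith)
import Data.List.Properties as List
open import Data.List.Extrema.Nat using (argmin; argmin-all; f[argmin]≤f[xs])
open import Data.List.Membership.Propositional using () renaming (_∈_ to _∈ˡ_)
open import Data.List.Membership.Propositional.Properties
  using (∈-allFin; ∈-∃++; ∈-cartesianProductWith⁺; ∈-filter⁺)
open import Data.List.Relation.Binary.Permutation.Propositional
  using (_↭_; ↭-refl; ↭-sym; ↭-trans; prep; ↭⇒↭ₛ)
open import Data.List.Relation.Binary.Permutation.Propositional.Properties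
  using (∈-resp-↭; ↭-length; shift; drop-mid)
import Data.List.Relation.Binary.Permutation.Setoid.Properties as PermutationSetoid
open import Data.List.Relation.Unary.All as All using (All; []; _∷_)
open import Data.List.Relation.Unary.All.Properties using (all-filter)
open import Data.List.Relation.Unary.AllPairs as AllPairs using (AllPairs; []; _∷_)
import Data.List.Relation.Unary.AllPairs.Properties as AllPairs
open import Data.List.Relation.Unary.Any as Any using (here; there)
import Data.List.Relation.Unary.Any.Properties as Any
open import Data.List.Relation.Unary.Sorted.TotalOrder.Properties using (Sorted⇒AllPairs)
import Data.List.Relation.Unary.Unique.Propositional.Properties as Unique
import Data.List.Sort as Sort
open import Data.Nat using (ℕ; zero; suc; _≤_; _<_; _∸_; _⊔_; _+_; _*_; z≤n; s≤s; _≤?_)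
open import Data.Nat.ListAction using (sum)
open import Data.Nat.Properties hiding (_≟_)
open import Data.Product using (Σ; ∃; _×_; _,_; proj₁; proj₂)
open import Data.Sum using (_⊎_; inj₁; inj₂)
import Data.Vec as Vec
import Data.Vec.Properties as Vec
open import Function using (_∘_; id; flip; case_of_)
open import Function.Bundles using (mk⇔)
open import Relation.Binary.Bundles using (DecTotalOrder)
import Relation.Binary.Construct.On as On
open import Relation.Binary.Definitions using (DecidableEquality)
open import Relation.Binary.PropositionalEquality hiding ([_])
open import Relation.Nullary using (¬_; Dec; yes; no; does; contradiction; _×-dec_)
open import Relation.Nullary.Decidable using (dec-true; dec-false; does-⇔)
open import Relation.Unary using (Pred; Decidable)


Adjacency : ℕ → Set
Adjacency n = Fin n → Fin n → Bool

countTrue : ∀ {n} → (Fin n → Bool) → ℕ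
countTrue f = sum (List.tabulate (λ w → if f w then 1 else 0))

degree≡countTrue : ∀ {n} (E : Adjacency n) v → degree E v ≡ countTrue (E v)
degree≡countTrue E v = cong sum (List.map-tabulate id (λ w → if E v w then 1 else 0))

∣tabulate∣≡countTrue : ∀ {n} (f : Fin n → Bool) → ∣ Vec.tabulate f ∣ ≡ countTrue f
∣tabulate∣≡countTrue {zero}  f = refl
∣tabulate∣≡countTrue {suc n} f with f zero
... | true  = cong suc (∣tabulate∣≡countTrue (f ∘ suc))
... | false = ∣tabulate∣≡countTrue (f ∘ suc)

countTrue-insert : ∀ {n} (v : Fin n) (g : Fin n → Bool) → g v ≡ false →
                   countTrue (λ w → does (w ≟ v) ∨ g w) ≡ suc (countTrue g)
countTrue-insert {suc n} zero    g gv rewrite gv = refl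
countTrue-insert {suc n} (suc v) g gv with g zero
... | true  = cong suc (countTrue-insert v (g ∘ suc) gv)
... | false = countTrue-insert v (g ∘ suc) gv

∈-tabulate⁺ : ∀ {n} (f : Fin n → Bool) {x} → f x ≡ true → x ∈ Vec.tabulate f
∈-tabulate⁺ f {x} fx = Vec.lookup⇒[]= x (Vec.tabulate f) (trans (Vec.lookup∘tabulate f x) fx)

∈-tabulate⁻ : ∀ {n} (f : Fin n → Bool) {x} → x ∈ Vec.tabulate f → f x ≡ true
∈-tabulate⁻ f {x} x∈ = trans (sym (Vec.lookup∘tabulate f x)) (Vec.[]=⇒lookup x∈)

maxF-cong : ∀ {k} {f g : Fin k → ℕ} → (∀ i → f i ≡ g i) → maxF f ≡ maxF g
maxF-cong {zero}  f≗g = refl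
maxF-cong {suc k} f≗g = cong₂ _⊔_ (f≗g zero) (maxF-cong (f≗g ∘ suc))

f≤maxF : ∀ {k} (f : Fin k → ℕ) i → f i ≤ maxF f
f≤maxF f zero    = m≤m⊔n _ _
f≤maxF f (suc i) = ≤-trans (f≤maxF (f ∘ suc) i) (m≤n⊔m (f zero) _)

snoc : ∀ {m} {A : Set} → (Fin m → A) → A → Fin (suc m) → A
snoc {zero}  f a zero    = a
snoc {suc m} f a zero    = f zero
snoc {suc m} f a (suc i) = snoc (f ∘ suc) a i

snoc-inject₁ : ∀ {m} {A : Set} (f : Fin m → A) a i → snoc f a (inject₁ i) ≡ f i
snoc-inject₁ f a zero    = refl
snoc-inject₁ f a (suc i) = snoc-inject₁ (f ∘ suc) a i

snoc-fromℕ : ∀ {m} {A : Set} (f : Fin m → A) a → snoc f a (fromℕ m) ≡ a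
snoc-fromℕ {zero}  f a = refl
snoc-fromℕ {suc m} f a = snoc-fromℕ (f ∘ suc) a

map-snoc : ∀ {m} {A B : Set} (g : A → B) (f : Fin m → A) a j → g (snoc f a j) ≡ snoc (g ∘ f) (g a) j
map-snoc {zero}  g f a zero    = refl
map-snoc {suc m} g f a zero    = refl
map-snoc {suc m} g f a (suc j) = map-snoc g (f ∘ suc) a j

maxF-snoc : ∀ {m} (f : Fin m → ℕ) a → maxF (snoc f a) ≡ maxF f ⊔ a
maxF-snoc {zero}  f a = ⊔-identityʳ a
maxF-snoc {suc m} f a = trans (cong (f zero ⊔_) (maxF-snoc (f ∘ suc) a)) (sym (⊔-assoc (f zero) _ a))

least : ∀ {m p} {P : Pred (Fin m) p} → Decidable P → ∃ P → ∃ λ a → P a × (∀ b → P b → toℕ a ≤ toℕ b)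
least P? (zero , p0) = zero , p0 , λ _ _ → z≤n
least P? (suc w , pw) with P? zero
... | yes p0 = zero , p0 , λ _ _ → z≤n
... | no ¬p0 with least (P? ∘ suc) (w , pw)
...   | a , pa , min = suc a , pa , λ { zero p → contradiction p ¬p0 ; (suc b) p → s≤s (min b p) }

greatest : ∀ {m p} {P : Pred (Fin m) p} → Decidable P → (key : Fin m → ℕ) →
           (∀ b → ¬ P b) ⊎ (∃ λ a → P a × (∀ b → P b → key b ≤ key a))
greatest {zero}  P? key = inj₁ λ ()
greatest {suc m} P? key with greatest (P? ∘ suc) (key ∘ suc) | P? zero
... | inj₁ none | no ¬p0 = inj₁ λ { zero → ¬p0 ; (suc b) → none b }
... | inj₁ none | yes p0 = inj₂ (zero , p0 , λ { zero _ → ≤-refl ; (suc b) p → contradiction p (none b) })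
... | inj₂ (a , pa , max) | no ¬p0 = inj₂ (suc a , pa , λ { zero p → contradiction p ¬p0 ; (suc b) → max b })
... | inj₂ (a , pa , max) | yes p0 with key zero ≤? key (suc a)
...   | yes ≤a = inj₂ (suc a , pa , λ { zero _ → ≤a ; (suc b) → max b })
...   | no ≰a = inj₂ (zero , p0 , λ { zero _ → ≤-refl ; (suc b) p → ≤-trans (max b p) (≰⇒≥ ≰a) })

module TreeOrder (T : RootedTree) where

  infix 4 _≤ᵀ_ _<ᵀ_
  _≤ᵀ_ _<ᵀ_ : Node T → Node T → Set
  _≤ᵀ_ = TreeLeq T
  _<ᵀ_ = TreeLt T

  ≤ᵀ⇒≤ : ∀ {t s} → t ≤ᵀ s → toℕ t ≤ toℕ s
  ≤ᵀ⇒≤ tl-refl = ≤-refl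
  ≤ᵀ⇒≤ (tl-step i t≤p) = ≤-trans (≤ᵀ⇒≤ t≤p) (≤-trans (parent< T i) (n≤1+n _))

  ≤ᵀ-parent⇒< : ∀ {t} i → t ≤ᵀ parent T i → toℕ t < toℕ (suc i)
  ≤ᵀ-parent⇒< i t≤p = s≤s (≤-trans (≤ᵀ⇒≤ t≤p) (parent< T i))

  <ᵀ⇒< : ∀ {t s} → t <ᵀ s → toℕ t < toℕ s
  <ᵀ⇒< (tl-refl , t≢t) = contradiction refl t≢t
  <ᵀ⇒< (tl-step i t≤p , _) = ≤ᵀ-parent⇒< i t≤p

  ≤ᵀ-trans : ∀ {a b c} → a ≤ᵀ b → b ≤ᵀ c → a ≤ᵀ c
  ≤ᵀ-trans a≤b tl-refl = a≤b
  ≤ᵀ-trans a≤b (tl-step i b≤p) = tl-step i (≤ᵀ-trans a≤b b≤p)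

  ≤ᵀ∧≥⇒≡ : ∀ {a b} → a ≤ᵀ b → toℕ b ≤ toℕ a → a ≡ b
  ≤ᵀ∧≥⇒≡ tl-refl _ = refl
  ≤ᵀ∧≥⇒≡ (tl-step i a≤p) b≤a = contradiction b≤a (<⇒≱ (≤ᵀ-parent⇒< i a≤p))

  ≤ᵀ-antisym : ∀ {a b} → a ≤ᵀ b → b ≤ᵀ a → a ≡ b
  ≤ᵀ-antisym a≤b b≤a = ≤ᵀ∧≥⇒≡ a≤b (≤ᵀ⇒≤ b≤a)

  ≤ᵀ-total-below : ∀ {a b s} → a ≤ᵀ s → b ≤ᵀ s → a ≤ᵀ b ⊎ b ≤ᵀ a
  ≤ᵀ-total-below tl-refl b≤s = inj₂ b≤s
  ≤ᵀ-total-below (tl-step i a≤p) tl-refl = inj₁ (tl-step i a≤p)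
  ≤ᵀ-total-below (tl-step i a≤p) (tl-step .i b≤p) = ≤ᵀ-total-below a≤p b≤p

  TAdj-sym : ∀ {t s} → TAdj T t s → TAdj T s t
  TAdj-sym (inj₁ e) = inj₂ e
  TAdj-sym (inj₂ e) = inj₁ e

  module _ {X : Node T → Set} where

    walk-head : ∀ {t s} → Walk T X t s → X t
    walk-head (here x) = x
    walk-head (step x _ _) = x

    _++ʷ_ : ∀ {t r s} → Walk T X t r → Walk T X r s → Walk T X t s
    here _ ++ʷ w′ = w′
    step x a w ++ʷ w′ = step x a (w ++ʷ w′)

    reverseʷ : ∀ {t s} → Walk T X t s → Walk T X s t
    reverseʷ (here x) = here x
    reverseʷ (step x a w) = reverseʷ w ++ʷ step (walk-head w) (TAdj-sym a) (here x)

    walk-common-ancestor : ∀ {t s} → Walk T X t s → ∃ λ m → X m × m ≤ᵀ t × m ≤ᵀ s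
    walk-common-ancestor (here x) = _ , x , tl-refl , tl-refl
    walk-common-ancestor (step xt a w) with walk-common-ancestor w | a
    ... | m , xm , m≤r , m≤s | inj₁ (i , refl , refl) = m , xm , tl-step i m≤r , m≤s
    ... | m , xm , tl-refl , m≤s | inj₂ (i , refl , refl) = _ , xt , tl-refl , ≤ᵀ-trans (tl-step i tl-refl) m≤s
    ... | m , xm , tl-step .i m≤t , m≤s | inj₂ (i , refl , refl) = m , xm , m≤t , m≤s

    walk-exit : ∀ {x y t} → Walk T X x y → t ≤ᵀ x → ¬ t ≤ᵀ y → X t
    walk-exit (here _) t≤x t≰y = contradiction t≤x t≰y
    walk-exit (step xx (inj₁ (i , refl , refl)) w) tl-refl t≰y = xx
    walk-exit (step xx (inj₁ (i , refl , refl)) w) (tl-step .i t≤p) t≰y = walk-exit w t≤p t≰y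
    walk-exit (step xx (inj₂ (i , refl , refl)) w) t≤x t≰y = walk-exit w (tl-step i t≤x) t≰y

module _ {n} (E : Adjacency n) (v : Fin n) where

  private
    ∨-true⁻ : ∀ a {b} → a ∨ b ≡ true → a ≡ true ⊎ b ≡ true
    ∨-true⁻ true  _ = inj₁ refl
    ∨-true⁻ false b = inj₂ b

    ∧-true⁻ : ∀ a {b} → a ∧ b ≡ true → a ≡ true × b ≡ true
    ∧-true⁻ true b = refl , b

    not-does⇒¬ : ∀ {P : Set} (p? : Dec P) → not (does p?) ≡ true → ¬ P
    not-does⇒¬ (no ¬p) _ = ¬p

  eliminate-true⁻ : ∀ u w → eliminate E v u w ≡ true →
                    (E u w ≡ true × u ≢ v × w ≢ v) ⊎ (u ≢ w × E u v ≡ true × E v w ≡ true)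
  eliminate-true⁻ u w e with ∨-true⁻ (E u w ∧ not (does (u ≟ v)) ∧ not (does (w ≟ v))) e
  ... | inj₁ kept
    with euw , rest ← ∧-true⁻ (E u w) kept
    with u≠v , w≠v ← ∧-true⁻ (not (does (u ≟ v))) rest
    = inj₁ (euw , not-does⇒¬ (u ≟ v) u≠v , not-does⇒¬ (w ≟ v) w≠v)
  ... | inj₂ filled
    with u≠w , rest ← ∧-true⁻ (not (does (u ≟ w))) filled
    with euv , evw ← ∧-true⁻ (E u v) rest
    = inj₂ (not-does⇒¬ (u ≟ w) u≠w , euv , evw)

  eliminate-keep : ∀ {u w} → E u w ≡ true → u ≢ v → w ≢ v → eliminate E v u w ≡ true
  eliminate-keep {u} {w} euw u≢v w≢v rewrite euw | dec-false (u ≟ v) u≢v | dec-false (w ≟ v) w≢v = refl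

  eliminate-fill : ∀ {u w} → u ≢ w → E u v ≡ true → E v w ≡ true → eliminate E v u w ≡ true
  eliminate-fill {u} {w} u≢w euv evw rewrite dec-false (u ≟ w) u≢w | euv | evw = ∨-zeroʳ _

  eliminate-irrefl : ∀ u → E u u ≡ false → eliminate E v u u ≡ false
  eliminate-irrefl u euu rewrite euu | dec-true (u ≟ u) refl = refl

  eliminate-sym : (∀ a b → E a b ≡ E b a) → ∀ u w → eliminate E v u w ≡ eliminate E v w u
  eliminate-sym E-sym u w
    rewrite E-sym u w | E-sym u v | E-sym v w | does-⇔ (mk⇔ sym sym) (u ≟ w) (w ≟ u)
          | ∧-comm (not (does (u ≟ v))) (not (does (w ≟ v))) | ∧-comm (E w v) (E v u) = refl

closedNbhd : ∀ {n} → Adjacency n → Fin n → Subset n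
closedNbhd E v = Vec.tabulate (λ w → does (w ≟ v) ∨ E v w)

module _ {n} (E : Adjacency n) {v : Fin n} where

  ∣closedNbhd∣ : E v v ≡ false → ∣ closedNbhd E v ∣ ≡ suc (degree E v)
  ∣closedNbhd∣ evv = begin
    ∣ closedNbhd E v ∣                         ≡⟨ ∣tabulate∣≡countTrue (λ w → does (w ≟ v) ∨ E v w) ⟩
    countTrue (λ w → does (w ≟ v) ∨ E v w)   ≡⟨ countTrue-insert v (E v) evv ⟩
    suc (countTrue (E v))                      ≡⟨ cong suc (degree≡countTrue E v) ⟨
    suc (degree E v)                           ∎
    where open ≡-Reasoning

  v∈closedNbhd : v ∈ closedNbhd E v
  v∈closedNbhd = ∈-tabulate⁺ _ (cong (_∨ E v v) (dec-true (v ≟ v) refl))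

  nbr∈closedNbhd : ∀ {x} → E v x ≡ true → x ∈ closedNbhd E v
  nbr∈closedNbhd {x} evx = ∈-tabulate⁺ _ (trans (cong (does (x ≟ v) ∨_) evx) (∨-zeroʳ _))

  ∈-closedNbhd⁻ : ∀ {x} → x ∈ closedNbhd E v → x ≡ v ⊎ E v x ≡ true
  ∈-closedNbhd⁻ {x} x∈ with x ≟ v | ∈-tabulate⁻ _ x∈
  ... | yes x≡v | _   = inj₁ x≡v
  ... | no _    | evx = inj₂ evx

AllPairs-reverse⁺ : ∀ {A : Set} {R : A → A → Set} {xs} → AllPairs R xs → AllPairs (flip R) (reverse xs)
AllPairs-reverse⁺ [] = []
AllPairs-reverse⁺ {xs = x ∷ xs} (Rx ∷ Rxs) rewrite List.unfold-reverse x xs =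
  AllPairs.++⁺ (AllPairs-reverse⁺ Rxs) ([] ∷ []) (All.tabulate λ y∈ → All.lookup Rx (Any.reverse⁻ y∈) ∷ [])

↭-dec : ∀ {A : Set} → DecidableEquality A → (xs ys : List A) → Dec (xs ↭ ys)
↭-dec _≟ᴬ_ [] [] = yes ↭-refl
↭-dec _≟ᴬ_ [] (y ∷ ys) = no λ p → contradiction (↭-length p) λ ()
↭-dec _≟ᴬ_ (x ∷ xs) ys with Any.any? (x ≟ᴬ_) ys
... | no x∉ys = no λ p → x∉ys (∈-resp-↭ p (here refl))
... | yes x∈ys with as , bs , refl ← ∈-∃++ x∈ys with ↭-dec _≟ᴬ_ xs (as ++ bs)
...   | yes p = yes (↭-trans (prep x p) (↭-sym (shift x as bs)))
...   | no ¬p = no λ q → ¬p (drop-mid [] as q)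

listsOfLength : ∀ {A : Set} → List A → ℕ → List (List A)
listsOfLength xs zero    = [ [] ]
listsOfLength xs (suc k) = cartesianProductWith _∷_ xs (listsOfLength xs k)

∈-listsOfLength : ∀ {A : Set} {xs : List A} ys → All (_∈ˡ xs) ys → ys ∈ˡ listsOfLength xs (length ys)
∈-listsOfLength []       []           = here refl
∈-listsOfLength (y ∷ ys) (y∈ ∷ ys∈) = ∈-cartesianProductWith⁺ _∷_ y∈ (∈-listsOfLength ys ys∈)

sortedBy : ∀ {n} (key : Fin n → ℕ) → ∃ λ vs → vs ↭ allFin n × AllPairs (λ u v → key u ≤ key v) vs
sortedBy {n} key = sort (allFin n) , sort-↭ (allFin n) , Sorted⇒AllPairs (DecTotalOrder.totalOrder O) (sort-↗ (allFin n))
  where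
  O = On.decTotalOrder ≤-decTotalOrder key
  open Sort O

∈-ordering : ∀ {n} {vs : List (Fin n)} → vs ↭ allFin n → ∀ x → x ∈ˡ vs
∈-ordering vs↭ x = ∈-resp-↭ (↭-sym vs↭) (∈-allFin x)

∈-rest : ∀ {n} {x v : Fin n} {rest} → x ∈ˡ v ∷ rest → x ≢ v → x ∈ˡ rest
∈-rest (here x≡v) x≢v = contradiction x≡v x≢v
∈-rest (there x∈) _   = x∈

module FromDecomposition {n} {G : Graph n} {T : RootedTree} (D : TreeDecomposition G T) where

  open TreeOrder T

  least-node : ∀ v → ∃ λ t → v ∈ bag D t × (∀ s → v ∈ bag D s → toℕ t ≤ toℕ s)
  least-node v = least (λ t → v Subset.∈? bag D t) (cover D v)

  top : Fin n → Node T
  top v = proj₁ (least-node v)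

  ∈-top : ∀ v → v ∈ bag D (top v)
  ∈-top v = proj₁ (proj₂ (least-node v))

  top-least : ∀ v {s} → v ∈ bag D s → toℕ (top v) ≤ toℕ s
  top-least v {s} = proj₂ (proj₂ (least-node v)) s

  -- The index-least piece containing v is also ≤ᵀ-least: a walk inside the pieces containing v
  -- joins it to any other such piece through a common ancestor.
  top-≤ᵀ : ∀ v {t} → v ∈ bag D t → top v ≤ᵀ t
  top-≤ᵀ v {t} v∈t with walk-common-ancestor (connected D v (top v) t (∈-top v) v∈t)
  ... | m , v∈m , m≤top , m≤t =
    subst (_≤ᵀ t) (≤ᵀ∧≥⇒≡ m≤top (top-least v v∈m)) m≤t

  isTop-top : ∀ v → IsTop D v (top v)
  isTop-top v = ∈-top v , λ t v∈t t<top → <⇒≱ (<ᵀ⇒< t<top) (top-least v v∈t)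

  SharePiece : Fin n → Fin n → Set
  SharePiece u w = ∃ λ s → u ∈ bag D s × w ∈ bag D s

  CoveredAtTop : Fin n → Fin n → Set
  CoveredAtTop v u = ∀ s → v ∈ bag D s → u ∈ bag D s → u ∈ bag D (top v)

  -- If t_u ≤ᵀ t_v, the pieces containing u lead from a common piece of u and v up to t_u,
  -- so they pass through t_v.
  top-≤ᵀ⇒covered : ∀ {u v} → top u ≤ᵀ top v → CoveredAtTop v u
  top-≤ᵀ⇒covered {u} {v} tu≤tv s v∈s u∈s with top u ≟ top v
  ... | yes tu≡tv = subst (λ t → u ∈ bag D t) tu≡tv (∈-top u)
  ... | no tu≢tv = walk-exit (connected D u s (top u) u∈s (∈-top u)) (top-≤ᵀ v v∈s)
                             (λ tv≤tu → tu≢tv (≤ᵀ-antisym tu≤tv tv≤tu))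

  record Supported (rs : List (Fin n)) (E : Adjacency n) : Set where
    field
      edge-supported : ∀ u w → E u w ≡ true → u ∈ˡ rs × w ∈ˡ rs × SharePiece u w
      irreflexive    : ∀ u → E u u ≡ false
  open Supported

  nbr∈top : ∀ {v rest x} → All (CoveredAtTop v) rest → x ∈ˡ v ∷ rest → SharePiece v x → x ∈ bag D (top v)
  nbr∈top covered (here refl) _ = ∈-top _
  nbr∈top covered (there x∈) (s , v∈s , x∈s) = All.lookup covered x∈ s v∈s x∈s

  degree≤width : ∀ {v rest E} → Supported (v ∷ rest) E → All (CoveredAtTop v) rest → degree E v ≤ width D
  degree≤width {v} {rest} {E} sup covered = ∸-monoˡ-≤ 1 (begin
    suc (degree E v)          ≡⟨ ∣closedNbhd∣ E (irreflexive sup v) ⟨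
    ∣ closedNbhd E v ∣        ≤⟨ Subset.p⊆q⇒∣p∣≤∣q∣ closedNbhd⊆top ⟩
    ∣ bag D (top v) ∣         ≤⟨ f≤maxF (λ t → ∣ bag D t ∣) (top v) ⟩
    maxF (λ t → ∣ bag D t ∣)  ∎)
    where
    open ≤-Reasoning
    closedNbhd⊆top : ∀ {x} → x ∈ closedNbhd E v → x ∈ bag D (top v)
    closedNbhd⊆top x∈ with ∈-closedNbhd⁻ E x∈
    ... | inj₁ refl = ∈-top v
    ... | inj₂ evx with _ , x∈rs , shared ← edge-supported sup v _ evx = nbr∈top covered x∈rs shared

  -- The fill-in edges created by eliminating v join two vertices of the piece t_v.
  eliminate-supported : ∀ {v rest E} → Supported (v ∷ rest) E → All (CoveredAtTop v) rest →
                        Supported rest (eliminate E v)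
  eliminate-supported {v} {rest} {E} sup covered = record
    { edge-supported = edge′ ; irreflexive = λ u → eliminate-irrefl E v u (irreflexive sup u) }
    where
    edge⇒≢ : ∀ {a b} → E a b ≡ true → a ≢ b
    edge⇒≢ {a} eab refl = contradiction (trans (sym eab) (irreflexive sup a)) λ ()
    edge′ : ∀ u w → eliminate E v u w ≡ true → u ∈ˡ rest × w ∈ˡ rest × SharePiece u w
    edge′ u w e with eliminate-true⁻ E v u w e
    ... | inj₁ (euw , u≢v , w≢v) with u∈ , w∈ , shared ← edge-supported sup u w euw =
      ∈-rest u∈ u≢v , ∈-rest w∈ w≢v , shared
    ... | inj₂ (_ , euv , evw)
      with u∈ , _ , (s , u∈s , v∈s) ← edge-supported sup u v euv
         | _ , w∈ , v-w ← edge-supported sup v w evw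
      = ∈-rest u∈ (edge⇒≢ euv) , ∈-rest w∈ (≢-sym (edge⇒≢ evw)) , top v ,
        nbr∈top covered (there (∈-rest u∈ (edge⇒≢ euv))) (s , v∈s , u∈s) ,
        nbr∈top covered (there (∈-rest w∈ (≢-sym (edge⇒≢ evw)))) v-w

  elimWidth≤width : ∀ {rs E} → Supported rs E → AllPairs CoveredAtTop rs → elimWidth rs E ≤ width D
  elimWidth≤width {[]}       _   _                       = z≤n
  elimWidth≤width {v ∷ rest} sup (covered ∷ coveredRest) =
    ⊔-lub (degree≤width sup covered) (elimWidth≤width (eliminate-supported sup covered) coveredRest)

  module _ (d : Fin n → ℕ) (stratified : Stratified d D) where

    -- Sorting by key sorts by d first and then by the index of t_v, since toℕ (top v) < suc (size T).
    key : Fin n → ℕ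
    key v = d v * suc (size T) + toℕ (top v)

    key-≤⇒d-≤ : ∀ {u v} → key u ≤ key v → d u ≤ d v
    key-≤⇒d-≤ {u} {v} ku≤kv with d u ≤? d v
    ... | yes du≤dv = du≤dv
    ... | no du≰dv = contradiction ku≤kv (<⇒≱ (begin-strict
      d v * N + toℕ (top v)  <⟨ +-monoʳ-< (d v * N) (toℕ<n (top v)) ⟩
      d v * N + N            ≡⟨ +-comm (d v * N) N ⟩
      suc (d v) * N          ≤⟨ *-monoˡ-≤ N (≰⇒> du≰dv) ⟩
      d u * N                ≤⟨ m≤m+n (d u * N) _ ⟩
      key u                  ∎))
      where
      N = suc (size T)
      open ≤-Reasoning

    key-≤⇒top-≤ : ∀ {u v} → key u ≤ key v → d u ≡ d v → toℕ (top u) ≤ toℕ (top v)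
    key-≤⇒top-≤ {u} {v} ku≤kv du≡dv rewrite du≡dv = +-cancelˡ-≤ (d v * suc (size T)) _ _ ku≤kv

    key-≤⇒covered : ∀ {u v} → key u ≤ key v → CoveredAtTop v u
    key-≤⇒covered {u} {v} ku≤kv s v∈s u∈s with ≤ᵀ-total-below (top-≤ᵀ u u∈s) (top-≤ᵀ v v∈s)
    ... | inj₁ tu≤tv = top-≤ᵀ⇒covered tu≤tv s v∈s u∈s
    ... | inj₂ tv≤tu with top v ≟ top u
    ...   | yes tv≡tu = top-≤ᵀ⇒covered (subst (_≤ᵀ top v) tv≡tu tl-refl) s v∈s u∈s
    ...   | no tv≢tu = contradiction (key-≤⇒top-≤ ku≤kv du≡dv) (<⇒≱ (<ᵀ⇒< tv<tu))
      where
      tv<tu : top v <ᵀ top u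
      tv<tu = tv≤tu , tv≢tu
      du≡dv : d u ≡ d v
      du≡dv = ≤-antisym (key-≤⇒d-≤ ku≤kv) (stratified v u _ _ (isTop-top v) (isTop-top u) tv<tu)

    decomposition⇒ordering : ∃ λ vs → IsElimOrdering d vs × orderingWidth G vs ≤ width D
    decomposition⇒ordering with vs , vs↭ , sorted ← sortedBy key =
      vs , (vs↭ , AllPairs.map key-≤⇒d-≤ sorted) ,
      elimWidth≤width supported (AllPairs.map key-≤⇒covered (AllPairs-reverse⁺ sorted))
      where
      ∈-reverse : ∀ x → x ∈ˡ reverse vs
      ∈-reverse x = Any.reverse⁺ (∈-ordering vs↭ x)
      supported : Supported (reverse vs) (adj G)
      supported = record
        { edge-supported = λ u w e → ∈-reverse u , ∈-reverse w , edgeCover D u w e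
        ; irreflexive = irrefl G }

module AddLeaf (T : RootedTree) (q : Node T) where

  tree : RootedTree
  tree = record { size = suc (size T) ; parent = parent′ ; parent< = parent′< }
    where
    parent′ : Fin (suc (size T)) → Fin (suc (suc (size T)))
    parent′ = snoc (inject₁ ∘ parent T) (inject₁ q)
    parent′< : ∀ j → toℕ (parent′ j) ≤ toℕ j
    parent′< j with view j
    ... | ‵inject₁ i = subst₂ _≤_
      (sym (trans (cong toℕ (snoc-inject₁ (inject₁ ∘ parent T) (inject₁ q) i)) (toℕ-inject₁ (parent T i))))
      (sym (toℕ-inject₁ i)) (parent< T i)
    ... | ‵fromℕ = subst₂ _≤_
      (sym (trans (cong toℕ (snoc-fromℕ (inject₁ ∘ parent T) (inject₁ q))) (toℕ-inject₁ q)))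
      (sym (toℕ-fromℕ (size T))) (≤-pred (toℕ<n q))

  leaf : Node tree
  leaf = fromℕ (suc (size T))

  ι : Node T → Node tree
  ι = inject₁

  parent-ι : ∀ i → parent tree (inject₁ i) ≡ ι (parent T i)
  parent-ι = snoc-inject₁ (inject₁ ∘ parent T) (inject₁ q)

  parent-leaf : parent tree (fromℕ (size T)) ≡ ι q
  parent-leaf = snoc-fromℕ (inject₁ ∘ parent T) (inject₁ q)

  leaf-TAdj : TAdj tree leaf (ι q)
  leaf-TAdj = inj₁ (fromℕ (size T) , refl , sym parent-leaf)

  ι-≤ᵀ : ∀ {a b} → TreeLeq T a b → TreeLeq tree (ι a) (ι b)
  ι-≤ᵀ tl-refl = tl-refl
  ι-≤ᵀ {a} (tl-step i a≤p) = tl-step (inject₁ i) (subst (TreeLeq tree (ι a)) (sym (parent-ι i)) (ι-≤ᵀ a≤p))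

  ι-≤ᵀ-leaf : ∀ {a} → TreeLeq T a q → TreeLeq tree (ι a) leaf
  ι-≤ᵀ-leaf {a} a≤q = tl-step (fromℕ (size T)) (subst (TreeLeq tree (ι a)) (sym parent-leaf) (ι-≤ᵀ a≤q))

  ι-TAdj : ∀ {a b} → TAdj T a b → TAdj tree (ι a) (ι b)
  ι-TAdj (inj₁ (i , refl , refl)) = inj₁ (inject₁ i , refl , sym (parent-ι i))
  ι-TAdj (inj₂ (i , refl , refl)) = inj₂ (inject₁ i , refl , sym (parent-ι i))

  ι-walk : ∀ {X : Node T → Set} {X′ : Node tree → Set} → (∀ {r} → X r → X′ (ι r)) →
           ∀ {a b} → Walk T X a b → Walk tree X′ (ι a) (ι b)
  ι-walk f (here x) = here (f x)
  ι-walk f (step x a w) = step (f x) (ι-TAdj a) (ι-walk f w)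

  toℕ-leaf : toℕ leaf ≡ suc (size T)
  toℕ-leaf = toℕ-fromℕ (suc (size T))

  toℕ-ι : ∀ a → toℕ (ι a) ≡ toℕ a
  toℕ-ι = toℕ-inject₁

  toℕ-ι<toℕ-leaf : ∀ a → toℕ (ι a) < toℕ leaf
  toℕ-ι<toℕ-leaf a rewrite toℕ-ι a | toℕ-leaf = toℕ<n a

module FromOrdering {n} (d : Fin n → ℕ) where

  -- The field nbr∈top is the extra invariant that makes the inductive step go through.
  record Decomposition (rs : List (Fin n)) (E : Adjacency n) : Set where
    field
      tree           : RootedTree
      piece          : Node tree → Subset n
      top            : Fin n → Node tree
      piece⊆rs       : ∀ t {x} → x ∈ piece t → x ∈ˡ rs
      ∈-top          : ∀ {x} → x ∈ˡ rs → x ∈ piece (top x)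
      edge-covered   : ∀ u w → E u w ≡ true → ∃ λ t → u ∈ piece t × w ∈ piece t
      walk-to-top    : ∀ {x t} → x ∈ piece t → Walk tree (λ s → x ∈ piece s) t (top x)
      top-≤ᵀ         : ∀ {x t} → x ∈ piece t → TreeLeq tree (top x) t
      top-injective  : ∀ {x y} → x ∈ˡ rs → y ∈ˡ rs → top x ≡ top y → x ≡ y
      top-stratified : ∀ {x y} → x ∈ˡ rs → y ∈ˡ rs → toℕ (top x) < toℕ (top y) → d x ≤ d y
      nbr∈top        : ∀ {u w} → u ∈ˡ rs → E u w ≡ true → toℕ (top w) < toℕ (top u) → w ∈ piece (top u)
      width≡         : maxF (λ t → ∣ piece t ∣) ∸ 1 ≡ elimWidth rs E

  singleNode : RootedTree
  singleNode = record { size = 0 ; parent = λ () ; parent< = λ () }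

  empty : ∀ {E} → (∀ u w → E u w ≡ true → u ∈ˡ []) → Decomposition [] E
  empty edge∈ = record
    { tree = singleNode ; piece = λ _ → ∅ ; top = λ _ → zero
    ; piece⊆rs = λ _ x∈ → contradiction x∈ Subset.∉⊥
    ; ∈-top = λ ()
    ; edge-covered = λ u w e → case edge∈ u w e of λ ()
    ; walk-to-top = λ x∈ → contradiction x∈ Subset.∉⊥
    ; top-≤ᵀ = λ x∈ → contradiction x∈ Subset.∉⊥
    ; top-injective = λ ()
    ; top-stratified = λ ()
    ; nbr∈top = λ ()
    ; width≡ = cong (_∸ 1) (trans (⊔-identityʳ _) (Subset.∣⊥∣≡0 n)) }

  record GraphOn (rs : List (Fin n)) (E : Adjacency n) : Set where
    field
      symmetric   : ∀ u w → E u w ≡ E w u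
      irreflexive : ∀ u → E u u ≡ false
      edge∈       : ∀ u w → E u w ≡ true → u ∈ˡ rs

  module _ {v rest E} (GE : GraphOn (v ∷ rest) E) where

    open GraphOn GE

    nbr≢v : ∀ {x} → E v x ≡ true → x ≢ v
    nbr≢v {x} evx refl = contradiction (trans (sym evx) (irreflexive x)) λ ()

    nbr∈rest : ∀ {x} → E v x ≡ true → x ∈ˡ rest
    nbr∈rest {x} evx = ∈-rest (edge∈ x v (trans (symmetric x v) evx)) (nbr≢v evx)

    eliminate-graphOn : GraphOn rest (eliminate E v)
    eliminate-graphOn = record
      { symmetric = eliminate-sym E v symmetric
      ; irreflexive = λ u → eliminate-irrefl E v u (irreflexive u)
      ; edge∈ = edge∈′ }
      where
      edge∈′ : ∀ u w → eliminate E v u w ≡ true → u ∈ˡ rest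
      edge∈′ u w e with eliminate-true⁻ E v u w e
      ... | inj₁ (euw , u≢v , _) = ∈-rest (edge∈ u w euw) u≢v
      ... | inj₂ (_ , euv , _) = nbr∈rest (trans (symmetric v u) euv)

  module Step {v rest E} (GE : GraphOn (v ∷ rest) E)
              (v∉rest : All (v ≢_) rest) (d≤dv : All (λ b → d b ≤ d v) rest)
              (R : Decomposition rest (eliminate E v)) where

    open GraphOn GE
    private module R = Decomposition R

    rest≢v : ∀ {x} → x ∈ˡ rest → x ≢ v
    rest≢v x∈ x≡v = All.lookup v∉rest x∈ (sym x≡v)

    -- The neighbours of v are pairwise adjacent once v is eliminated, so by nbr∈top they all lie
    -- in the piece of the neighbour whose node was created last.
    anchor : ∃ λ q → ∀ {x} → E v x ≡ true → x ∈ R.piece q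
    anchor with greatest (λ w → E v w Bool.≟ true) (toℕ ∘ R.top)
    ... | inj₁ none = zero , λ {x} evx → contradiction evx (none x)
    ... | inj₂ (a , eva , max) = R.top a , nbr∈
      where
      nbr∈ : ∀ {x} → E v x ≡ true → x ∈ R.piece (R.top a)
      nbr∈ {x} evx with x ≟ a
      ... | yes refl = R.∈-top (nbr∈rest GE evx)
      ... | no x≢a = R.nbr∈top (nbr∈rest GE eva)
        (eliminate-fill E v (≢-sym x≢a) (trans (symmetric a v) eva) evx)
        (≤∧≢⇒< (max x evx) (x≢a ∘ R.top-injective (nbr∈rest GE evx) (nbr∈rest GE eva) ∘ toℕ-injective))

    open AddLeaf R.tree (proj₁ anchor)

    piece : Node tree → Subset n
    piece = snoc R.piece (closedNbhd E v)

    top : Fin n → Node tree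
    top x = if does (x ≟ v) then leaf else ι (R.top x)

    top-v : top v ≡ leaf
    top-v rewrite dec-true (v ≟ v) refl = refl

    top-rest : ∀ {x} → x ≢ v → top x ≡ ι (R.top x)
    top-rest {x} x≢v rewrite dec-false (x ≟ v) x≢v = refl

    ∈-ι⁺ : ∀ {x} r → x ∈ R.piece r → x ∈ piece (ι r)
    ∈-ι⁺ {x} r = subst (x ∈_) (sym (snoc-inject₁ R.piece (closedNbhd E v) r))

    ∈-ι⁻ : ∀ {x} r → x ∈ piece (ι r) → x ∈ R.piece r
    ∈-ι⁻ {x} r = subst (x ∈_) (snoc-inject₁ R.piece (closedNbhd E v) r)

    ∈-leaf⁺ : ∀ {x} → x ∈ closedNbhd E v → x ∈ piece leaf
    ∈-leaf⁺ {x} = subst (x ∈_) (sym (snoc-fromℕ R.piece (closedNbhd E v)))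

    ∈-leaf⁻ : ∀ {x} → x ∈ piece leaf → x ∈ closedNbhd E v
    ∈-leaf⁻ {x} = subst (x ∈_) (snoc-fromℕ R.piece (closedNbhd E v))

    piece⊆rs : ∀ t {x} → x ∈ piece t → x ∈ˡ v ∷ rest
    piece⊆rs t x∈ with view t
    ... | ‵inject₁ r = there (R.piece⊆rs r (∈-ι⁻ r x∈))
    ... | ‵fromℕ with ∈-closedNbhd⁻ E (∈-leaf⁻ x∈)
    ...   | inj₁ refl = here refl
    ...   | inj₂ evx = there (nbr∈rest GE evx)

    ∈-top : ∀ {x} → x ∈ˡ v ∷ rest → x ∈ piece (top x)
    ∈-top {x} x∈ with x ≟ v
    ... | yes refl = ∈-leaf⁺ (v∈closedNbhd E)
    ... | no x≢v = ∈-ι⁺ _ (R.∈-top (∈-rest x∈ x≢v))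

    edge-covered : ∀ u w → E u w ≡ true → ∃ λ t → u ∈ piece t × w ∈ piece t
    edge-covered u w e with u ≟ v | w ≟ v
    ... | yes refl | _ = leaf , ∈-leaf⁺ (v∈closedNbhd E) , ∈-leaf⁺ (nbr∈closedNbhd E e)
    ... | no _ | yes refl = leaf , ∈-leaf⁺ (nbr∈closedNbhd E (trans (symmetric v u) e)) , ∈-leaf⁺ (v∈closedNbhd E)
    ... | no u≢v | no w≢v with t , u∈ , w∈ ← R.edge-covered u w (eliminate-keep E v e u≢v w≢v) =
      ι t , ∈-ι⁺ t u∈ , ∈-ι⁺ t w∈

    walk-to-top : ∀ {x t} → x ∈ piece t → Walk tree (λ s → x ∈ piece s) t (top x)
    walk-to-top {x} {t} x∈ with view t
    ... | ‵inject₁ r = subst (Walk tree _ (ι r)) (sym (top-rest (rest≢v (R.piece⊆rs r (∈-ι⁻ r x∈)))))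
                             (ι-walk (∈-ι⁺ _) (R.walk-to-top (∈-ι⁻ r x∈)))
    ... | ‵fromℕ with ∈-closedNbhd⁻ E (∈-leaf⁻ x∈)
    ...   | inj₁ refl = subst (Walk tree _ leaf) (sym top-v) (here x∈)
    ...   | inj₂ evx = subst (Walk tree _ leaf) (sym (top-rest (nbr≢v GE evx)))
                             (step x∈ leaf-TAdj (ι-walk (∈-ι⁺ _) (R.walk-to-top (proj₂ anchor evx))))

    top-≤ᵀ : ∀ {x t} → x ∈ piece t → TreeLeq tree (top x) t
    top-≤ᵀ {x} {t} x∈ with view t
    ... | ‵inject₁ r = subst (λ s → TreeLeq tree s (ι r)) (sym (top-rest (rest≢v (R.piece⊆rs r (∈-ι⁻ r x∈)))))
                             (ι-≤ᵀ (R.top-≤ᵀ (∈-ι⁻ r x∈)))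
    ... | ‵fromℕ with ∈-closedNbhd⁻ E (∈-leaf⁻ x∈)
    ...   | inj₁ refl = subst (λ s → TreeLeq tree s leaf) (sym top-v) tl-refl
    ...   | inj₂ evx = subst (λ s → TreeLeq tree s leaf) (sym (top-rest (nbr≢v GE evx)))
                             (ι-≤ᵀ-leaf (R.top-≤ᵀ (proj₂ anchor evx)))

    top-injective : ∀ {x y} → x ∈ˡ v ∷ rest → y ∈ˡ v ∷ rest → top x ≡ top y → x ≡ y
    top-injective {x} {y} x∈ y∈ tx≡ty with x ≟ v | y ≟ v
    ... | yes refl | yes refl = refl
    ... | yes refl | no _ = contradiction (cong toℕ (sym tx≡ty)) (<⇒≢ (toℕ-ι<toℕ-leaf _))
    ... | no _ | yes refl = contradiction (cong toℕ tx≡ty) (<⇒≢ (toℕ-ι<toℕ-leaf _))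
    ... | no x≢v | no y≢v = R.top-injective (∈-rest x∈ x≢v) (∈-rest y∈ y≢v) (inject₁-injective tx≡ty)

    top-stratified : ∀ {x y} → x ∈ˡ v ∷ rest → y ∈ˡ v ∷ rest → toℕ (top x) < toℕ (top y) → d x ≤ d y
    top-stratified {x} {y} x∈ y∈ tx<ty with x ≟ v | y ≟ v
    ... | yes refl | yes refl = contradiction tx<ty (<-irrefl refl)
    ... | yes refl | no _ = contradiction tx<ty (<-asym (toℕ-ι<toℕ-leaf _))
    ... | no x≢v | yes refl = All.lookup d≤dv (∈-rest x∈ x≢v)
    ... | no x≢v | no y≢v = R.top-stratified (∈-rest x∈ x≢v) (∈-rest y∈ y≢v)
                              (subst₂ _<_ (toℕ-ι _) (toℕ-ι _) tx<ty)

    nbr∈top : ∀ {u w} → u ∈ˡ v ∷ rest → E u w ≡ true → toℕ (top w) < toℕ (top u) → w ∈ piece (top u)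
    nbr∈top {u} {w} u∈ e tw<tu with u ≟ v | w ≟ v
    ... | yes refl | _ = ∈-leaf⁺ (nbr∈closedNbhd E e)
    ... | no _ | yes refl = contradiction tw<tu (<-asym (toℕ-ι<toℕ-leaf _))
    ... | no u≢v | no w≢v = ∈-ι⁺ _ (R.nbr∈top (∈-rest u∈ u≢v) (eliminate-keep E v e u≢v w≢v)
                                           (subst₂ _<_ (toℕ-ι _) (toℕ-ι _) tw<tu))

    width≡ : maxF (λ t → ∣ piece t ∣) ∸ 1 ≡ elimWidth (v ∷ rest) E
    width≡ = begin
      maxF (λ t → ∣ piece t ∣) ∸ 1                   ≡⟨ cong (_∸ 1) (maxF-cong (map-snoc ∣_∣ R.piece _)) ⟩
      maxF (snoc (λ t → ∣ R.piece t ∣) ∣ N ∣) ∸ 1   ≡⟨ cong (_∸ 1) (maxF-snoc (λ t → ∣ R.piece t ∣) _) ⟩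
      (M ⊔ ∣ N ∣) ∸ 1                                ≡⟨ cong (λ k → (M ⊔ k) ∸ 1) (∣closedNbhd∣ E (irreflexive v)) ⟩
      (M ⊔ suc (degree E v)) ∸ 1                     ≡⟨ ∸-distribʳ-⊔ 1 M _ ⟩
      (M ∸ 1) ⊔ degree E v                           ≡⟨ cong (_⊔ degree E v) R.width≡ ⟩
      elimWidth rest (eliminate E v) ⊔ degree E v    ≡⟨ ⊔-comm _ (degree E v) ⟩
      elimWidth (v ∷ rest) E                         ∎
      where
      open ≡-Reasoning
      M = maxF (λ t → ∣ R.piece t ∣)
      N = closedNbhd E v

    decomposition : Decomposition (v ∷ rest) E
    decomposition = record
      { tree = tree ; piece = piece ; top = top ; piece⊆rs = piece⊆rs ; ∈-top = ∈-top
      ; edge-covered = edge-covered ; walk-to-top = walk-to-top ; top-≤ᵀ = top-≤ᵀ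
      ; top-injective = top-injective ; top-stratified = top-stratified ; nbr∈top = nbr∈top
      ; width≡ = width≡ }

  build : ∀ {rs E} → GraphOn rs E → AllPairs _≢_ rs → AllPairs (λ a b → d b ≤ d a) rs → Decomposition rs E
  build {[]}       GE _               _             = empty (GraphOn.edge∈ GE)
  build {v ∷ rest} GE (v∉rest ∷ uniq) (d≤dv ∷ sorted) =
    Step.decomposition GE v∉rest d≤dv (build (eliminate-graphOn GE) uniq sorted)

module _ {n} (G : Graph n) (d : Fin n → ℕ) where

  ordering⇒decomposition : ∀ vs → IsElimOrdering d vs →
    Σ RootedTree λ T → Σ (TreeDecomposition G T) λ D → Stratified d D × width D ≡ orderingWidth G vs
  ordering⇒decomposition vs (vs↭ , sorted) = tree , D , stratified , width≡
    where
    open FromOrdering d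
    ∈-rs : ∀ x → x ∈ˡ reverse vs
    ∈-rs x = Any.reverse⁺ (∈-ordering vs↭ x)
    unique : AllPairs _≢_ (reverse vs)
    unique = AllPairs.map ≢-sym (AllPairs-reverse⁺
      (PermutationSetoid.Unique-resp-↭ (setoid (Fin n)) (↭⇒↭ₛ (↭-sym vs↭)) (Unique.allFin⁺ n)))
    R : Decomposition (reverse vs) (adj G)
    R = build (record { symmetric = Graph.sym G ; irreflexive = irrefl G ; edge∈ = λ u _ _ → ∈-rs u })
              unique (AllPairs-reverse⁺ sorted)
    open Decomposition R
    open TreeOrder tree
    D : TreeDecomposition G tree
    D = record
      { bag = piece ; cover = λ v → top v , ∈-top (∈-rs v) ; edgeCover = edge-covered
      ; connected = λ v t s v∈t v∈s → walk-to-top v∈t ++ʷ reverseʷ (walk-to-top v∈s) }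
    isTop⇒≡top : ∀ {u t} → IsTop D u t → t ≡ top u
    isTop⇒≡top {u} {t} (u∈t , minimal) with top u ≟ t
    ... | yes tu≡t = sym tu≡t
    ... | no tu≢t = contradiction (top-≤ᵀ u∈t , tu≢t) (minimal (top u) (∈-top (∈-rs u)))
    stratified : Stratified d D
    stratified u v t s isTop-u isTop-v t<s = top-stratified (∈-rs u) (∈-rs v)
      (subst₂ (λ a b → toℕ a < toℕ b) (isTop⇒≡top isTop-u) (isTop⇒≡top isTop-v) (<ᵀ⇒< t<s))

  optimalOrdering : ∃ (IsEw G d)
  optimalOrdering = orderingWidth G best , (best , isElim-best , refl) , optimal
    where
    isElim? : Decidable (IsElimOrdering d)
    isElim? vs = ↭-dec _≟_ vs (allFin n) ×-dec AllPairs.allPairs? (λ u v → d u ≤? d v) vs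
    candidates : List (List (Fin n))
    candidates = List.filter isElim? (listsOfLength (allFin n) n)
    someOrdering : ∃ (IsElimOrdering d)
    someOrdering = sortedBy d
    best : List (Fin n)
    best = argmin (orderingWidth G) (proj₁ someOrdering) candidates
    isElim-best : IsElimOrdering d best
    isElim-best = argmin-all (orderingWidth G) (proj₂ someOrdering) (all-filter isElim? (listsOfLength (allFin n) n))
    ∈-candidates : ∀ {vs} → IsElimOrdering d vs → vs ∈ˡ candidates
    ∈-candidates {vs} isElim@(vs↭ , _) = ∈-filter⁺ isElim?
      (subst (λ k → vs ∈ˡ listsOfLength (allFin n) k) (trans (↭-length vs↭) (List.length-tabulate {n = n} id))
             (∈-listsOfLength vs (All.tabulate λ {x} _ → ∈-allFin x)))
      isElim
    optimal : ∀ vs → IsElimOrdering d vs → orderingWidth G best ≤ orderingWidth G vs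
    optimal vs isElim = All.lookup (f[argmin]≤f[xs] (proj₁ someOrdering) candidates) (∈-candidates isElim)

theorem3p1 : (n : ℕ) (G : Graph n) (d : Fin n → ℕ) → ∃ λ k → IsTw G d k × IsEw G d k
theorem3p1 n G d with k , ew@((vs , isElim , refl) , optimal) ← optimalOrdering G d =
  k , (ordering⇒decomposition G d vs isElim , tw≥ew) , ew
  where
  tw≥ew : ∀ T (D : TreeDecomposition G T) → Stratified d D → k ≤ width D
  tw≥ew T D stratified with vs′ , isElim′ , vs′≤D ← FromDecomposition.decomposition⇒ordering D d stratified =
    ≤-trans (optimal vs′ isElim′) vs′≤D
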